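{- Let $A$ be a finite nonempty alphabet and let $S\subset A^*$ be a recurrent connected set with $A\subset S$. Then for every $n\ge 0$ and every vertex $v$ of the Rauzy graph $G_n(S)$, the group described by $G_n(S)$ with respect to $v$ is the free group $F_A$.
   Context: $S$ is factorial if it contains all factors of its elements; it is recurrent if $S\ne\{1\}$, $S$ is factorial, and for all $u,w\in S$ there is $v\in S$ with $uvw\in S$. For $w\in S$: $L(w)=\{a\in A\mid aw\in S\}$, $R(w)=\{a\in A\mid wa\in S\}$, $E(w)=\{(a,b)\mid awb\in S\}$; $S$ is biextendable if it is factorial and $E(w)\ne\emptyset$ for all $w\in S$. The extension graph of $w$ is the undirected bipartite graph with vertex set the disjoint union of $L(w)$ and $R(w)$ and an edge $a$–$b$ for each $(a,b)\in E(w)$. $S$ is connected if it is biextendable and every extension graph is connected. The Rauzy graph $G_n(S)$ is the labeled directed graph with vertex set $S\cap A^n$ and an edge $(x,a,y)$ labeled $a\in A$ whenever $x,y\in S\cap A^n$ and $xa\in S\cap Ay$. A generalized path in a labeled graph is a sequence $(p_0,a_1,p_1,\dots,a_m,p_m)$ with $a_i\in A\cup A^{ -1}$ such that there is an edge $(p_{i-1},a_i,p_i)$ if $a_i\in A$ and an edge $(p_i,a_i^{ -1},p_{i-1})$ if $a_i\in A^{ -1}$; its label is the reduced word equivalent to $a_1\cdots a_m$, an element of $F_A$. The group described by the graph with respect to a vertex $v$ is the set of labels of generalized paths from $v$ to $v$. -}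

module Defs where

open import Data.Nat using (ℕ; suc)
open import Data.Fin using (Fin)
open import Data.Fin.Properties using () renaming (_≟_ to _≟F_)
open import Data.List using (List; []; _∷_; _++_; length; foldr)
open import Data.Sum using (_⊎_; inj₁; inj₂)
open import Data.Sum.Properties using (≡-dec)
open import Data.Product using (Σ; _×_; _,_; ∃)
open import Relation.Nullary using (¬_; yes; no)
open import Relation.Binary.PropositionalEquality using (_≡_; _≢_)
open import Relation.Binary.Construct.Closure.ReflexiveTransitive using (Star)
open import Function.Bundles using (_⇔_)

Word : ℕ → Set
Word k = List (Fin k)

Lang : ℕ → Set₁
Lang k = Word k → Set

module _ {k : ℕ} (S : Lang k) where

  Factorial : Set
  Factorial = ∀ (u v w : Word k) → S (u ++ v ++ w) → S v

  NotTrivial : Set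
  NotTrivial = ¬ (∀ (w : Word k) → S w ⇔ (w ≡ []))

  Recurrent : Set
  Recurrent = NotTrivial × Factorial ×
    (∀ (u w : Word k) → S u → S w → Σ (Word k) λ v → S (u ++ v ++ w))

  Biextendable : Set
  Biextendable = Factorial ×
    (∀ (w : Word k) → S w → Σ (Fin k) λ a → Σ (Fin k) λ b → S (a ∷ w ++ b ∷ []))

  -- Extension graph of w: vertices L(w) ⊎ R(w) (inj₁ = left copy, inj₂ = right copy)
  ExtVertex : Word k → Fin k ⊎ Fin k → Set
  ExtVertex w (inj₁ a) = S (a ∷ w)
  ExtVertex w (inj₂ b) = S (w ++ b ∷ [])

  ExtEdge : Word k → Fin k ⊎ Fin k → Fin k ⊎ Fin k → Set
  ExtEdge w (inj₁ a) (inj₂ b) = S (a ∷ w ++ b ∷ [])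
  ExtEdge w (inj₂ b) (inj₁ a) = S (a ∷ w ++ b ∷ [])
  ExtEdge w (inj₁ _) (inj₁ _) = Data.Empty.⊥ where import Data.Empty
  ExtEdge w (inj₂ _) (inj₂ _) = Data.Empty.⊥ where import Data.Empty

  ExtGraphConnected : Word k → Set
  ExtGraphConnected w = ∀ x y → ExtVertex w x → ExtVertex w y → Star (ExtEdge w) x y

  Connected : Set
  Connected = Biextendable × (∀ (w : Word k) → S w → ExtGraphConnected w)

  RauzyVertex : ℕ → Word k → Set
  RauzyVertex n x = S x × length x ≡ n

  RauzyEdge : ℕ → Word k → Fin k → Word k → Set
  RauzyEdge n x a y = RauzyVertex n x × RauzyVertex n y × S (x ++ a ∷ []) ×
    Σ (Fin k) λ b → x ++ a ∷ [] ≡ b ∷ y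

-- Letters of A ∪ A⁻¹ : inj₁ a = a, inj₂ a = a⁻¹
Letter : ℕ → Set
Letter k = Fin k ⊎ Fin k

inv : ∀ {k} → Letter k → Letter k
inv (inj₁ a) = inj₂ a
inv (inj₂ a) = inj₁ a

push : ∀ {k} → Letter k → List (Letter k) → List (Letter k)
push x [] = x ∷ []
push x (y ∷ ys) with ≡-dec _≟F_ _≟F_ y (inv x)
... | yes _ = ys
... | no _ = x ∷ y ∷ ys

reduce : ∀ {k} → List (Letter k) → List (Letter k)
reduce = foldr push []

-- reduced words = elements of the free group F_A
Reduced : ∀ {k} → List (Letter k) → Set
Reduced {k} w = ∀ (u v : List (Letter k)) (x y : Letter k) → w ≡ u ++ x ∷ y ∷ v → y ≢ inv x

module _ {k : ℕ} (S : Lang k) (n : ℕ) where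
  data GenPath : Word k → Word k → List (Letter k) → Set where
    gnil : ∀ {p} → RauzyVertex S n p → GenPath p p []
    gfwd : ∀ {p p' q a ls} → RauzyEdge S n p a p' → GenPath p' q ls → GenPath p q (inj₁ a ∷ ls)
    gbwd : ∀ {p p' q a ls} → RauzyEdge S n p' a p → GenPath p' q ls → GenPath p q (inj₂ a ∷ ls)

  InDescribedGroup : Word k → List (Letter k) → Set
  InDescribedGroup v g = Σ (List (Letter k)) λ ls → GenPath v v ls × reduce ls ≡ g

-- The label map from generalized loops of G_n(S) at v to F_A is shown to be onto by
-- induction on n. In G_0 every letter is a loop at the empty word. A generalized path
-- of G_n from w to w' lifts, for any left extension b of w, to a path of G_(n+1) from
-- bw to some b'w' with the same value in F_A: each edge lifts to an edge starting in
-- the fibre over its source, and the fibre {cw} over w is joined inside G_(n+1) by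
-- paths of trivial value, because a walk b -a- b' in the extension graph of w is the
-- path bw -a-> wa <-a- b'w, whose label a a⁻¹ is trivial. Closing the lift of a loop
-- at w by such a path gives a loop at bw of the same value.
module Submission where

open import Defs
open import Data.Nat using (ℕ; zero; suc)
open import Data.Nat.Properties using (suc-injective; +-comm)
open import Data.Fin using (Fin)
open import Data.Fin.Properties using () renaming (_≟_ to _≟F_)
open import Data.List using (List; []; _∷_; length; _++_; foldr)
open import Data.List.Properties using (foldr-++; ++-identityʳ; length-++)
open import Data.Product using (Σ; _×_; _,_; proj₁; proj₂)
open import Data.Sum using (inj₁; inj₂)
open import Data.Sum.Properties using (≡-dec)
open import Data.Unit using (⊤; tt)
open import Data.Empty using (⊥-elim)
open import Relation.Nullary using (yes; no)
open import Relation.Binary.PropositionalEquality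
  using (_≡_; _≢_; refl; sym; trans; cong; subst)
open import Relation.Binary.Construct.Closure.ReflexiveTransitive using (Star; ε; _◅_)
open import Function.Base using (_∘_)
open import Function.Bundles using (_⇔_; mk⇔)

module FreeGroup {k : ℕ} where

  Reduced′ : List (Letter k) → Set
  Reduced′ []           = ⊤
  Reduced′ (_ ∷ [])     = ⊤
  Reduced′ (x ∷ y ∷ ys) = y ≢ inv x × Reduced′ (y ∷ ys)

  Reduced′-tail : ∀ {x} ys → Reduced′ (x ∷ ys) → Reduced′ ys
  Reduced′-tail []      _       = tt
  Reduced′-tail (_ ∷ _) (_ , r) = r

  Reduced′⇒Reduced : ∀ w → Reduced′ w → Reduced w
  Reduced′⇒Reduced w r u v x y refl = adjacent u r
    where
    adjacent : ∀ u → Reduced′ (u ++ x ∷ y ∷ v) → y ≢ inv x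
    adjacent []          (y≢x⁻¹ , _) = y≢x⁻¹
    adjacent (_ ∷ [])    (_ , r)     = proj₁ r
    adjacent (_ ∷ z ∷ u) (_ , r)     = adjacent (z ∷ u) r

  Reduced⇒Reduced′ : ∀ w → Reduced w → Reduced′ w
  Reduced⇒Reduced′ []           _ = tt
  Reduced⇒Reduced′ (_ ∷ [])     _ = tt
  Reduced⇒Reduced′ (x ∷ y ∷ ys) h =
    h [] ys x y refl , Reduced⇒Reduced′ (y ∷ ys) (λ u v x′ y′ eq → h (x ∷ u) v x′ y′ (cong (x ∷_) eq))

  inv-involutive : ∀ (x : Letter k) → inv (inv x) ≡ x
  inv-involutive (inj₁ _) = refl
  inv-involutive (inj₂ _) = refl

  push-cancels : ∀ (x : Letter k) y ys → y ≡ inv x → push x (y ∷ ys) ≡ ys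
  push-cancels x y ys y≡x⁻¹ with ≡-dec _≟F_ _≟F_ y (inv x)
  ... | yes _     = refl
  ... | no  y≢x⁻¹ = ⊥-elim (y≢x⁻¹ y≡x⁻¹)

  push-conses : ∀ (x : Letter k) y ys → y ≢ inv x → push x (y ∷ ys) ≡ x ∷ y ∷ ys
  push-conses x y ys y≢x⁻¹ with ≡-dec _≟F_ _≟F_ y (inv x)
  ... | yes y≡x⁻¹ = ⊥-elim (y≢x⁻¹ y≡x⁻¹)
  ... | no  _     = refl

  push-Reduced′ : ∀ (x : Letter k) u → Reduced′ u → Reduced′ (push x u)
  push-Reduced′ x []       _ = tt
  push-Reduced′ x (y ∷ ys) r with ≡-dec _≟F_ _≟F_ y (inv x)
  ... | yes _     = Reduced′-tail ys r
  ... | no  y≢x⁻¹ = y≢x⁻¹ , r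

  push-onto-Reduced′ : ∀ (x : Letter k) ys → Reduced′ (x ∷ ys) → push x ys ≡ x ∷ ys
  push-onto-Reduced′ x []       _           = refl
  push-onto-Reduced′ x (y ∷ ys) (y≢x⁻¹ , _) = push-conses x y ys y≢x⁻¹

  push-inv-cancel : ∀ (x : Letter k) u → Reduced′ u → push x (push (inv x) u) ≡ u
  push-inv-cancel x [] _ = push-cancels x (inv x) [] refl
  push-inv-cancel x (y ∷ ys) r with ≡-dec _≟F_ _≟F_ y (inv (inv x))
  ... | no  _   = push-cancels x (inv x) (y ∷ ys) refl
  ... | yes y≡x = subst (λ z → Reduced′ (z ∷ ys) → push x ys ≡ z ∷ ys)
                        (sym (trans y≡x (inv-involutive x))) (push-onto-Reduced′ x ys) r

  -- F_A acting on reduced words by left multiplication; reduce ls is ls · [].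
  infixr 5 _·_
  _·_ : List (Letter k) → List (Letter k) → List (Letter k)
  ls · u = foldr push u ls

  ·-Reduced′ : ∀ ls u → Reduced′ u → Reduced′ (ls · u)
  ·-Reduced′ []       u r = r
  ·-Reduced′ (x ∷ ls) u r = push-Reduced′ x (ls · u) (·-Reduced′ ls u r)

  reduce-Reduced : ∀ ls → Reduced (reduce ls)
  reduce-Reduced ls = Reduced′⇒Reduced (reduce ls) (·-Reduced′ ls [] tt)

  reduce-fixes-Reduced′ : ∀ g → Reduced′ g → reduce g ≡ g
  reduce-fixes-Reduced′ []           _             = refl
  reduce-fixes-Reduced′ (_ ∷ [])     _             = refl
  reduce-fixes-Reduced′ (x ∷ y ∷ ys) (y≢x⁻¹ , r) =
    trans (cong (push x) (reduce-fixes-Reduced′ (y ∷ ys) r)) (push-conses x y ys y≢x⁻¹)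

  -- Equality in F_A, defined through the action so that no normal-form theory is needed.
  infix 4 _≈_
  record _≈_ (ls ms : List (Letter k)) : Set where
    constructor mk≈
    field act-≡ : ∀ u → Reduced′ u → ls · u ≡ ms · u
  open _≈_

  ≈-refl : ∀ {ls} → ls ≈ ls
  ≈-refl = mk≈ λ _ _ → refl

  ≈-reflexive : ∀ {ls ms} → ls ≡ ms → ls ≈ ms
  ≈-reflexive refl = ≈-refl

  ≈-trans : ∀ {ls ms ns} → ls ≈ ms → ms ≈ ns → ls ≈ ns
  ≈-trans p q = mk≈ λ u r → trans (act-≡ p u r) (act-≡ q u r)

  ++-cong : ∀ {ls ls′ ms ms′} → ls ≈ ls′ → ms ≈ ms′ → ls ++ ms ≈ ls′ ++ ms′
  ++-cong {ls} {ls′} {ms} {ms′} p q = mk≈ λ u r → begin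
    (ls ++ ms) · u    ≡⟨ foldr-++ push u ls ms ⟩
    ls · ms · u       ≡⟨ cong (ls ·_) (act-≡ q u r) ⟩
    ls · ms′ · u      ≡⟨ act-≡ p (ms′ · u) (·-Reduced′ ms′ u r) ⟩
    ls′ · ms′ · u     ≡⟨ sym (foldr-++ push u ls′ ms′) ⟩
    (ls′ ++ ms′) · u  ∎
    where open Relation.Binary.PropositionalEquality.≡-Reasoning

  ∷-cong : ∀ x {ls ms} → ls ≈ ms → x ∷ ls ≈ x ∷ ms
  ∷-cong x = ++-cong {x ∷ []} ≈-refl

  cancel-pair : ∀ x {ls ms} → ls ≈ ms → x ∷ inv x ∷ ls ≈ ms
  cancel-pair x {ls} p = mk≈ λ u r → trans (push-inv-cancel x (ls · u) (·-Reduced′ ls u r)) (act-≡ p u r)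

  reduce-cong : ∀ {ls ms} → ls ≈ ms → reduce ls ≡ reduce ms
  reduce-cong p = act-≡ p [] tt

module RauzyPaths {k : ℕ} (S : Lang k) where
  open FreeGroup {k}

  infixr 5 _++ᵍ_
  _++ᵍ_ : ∀ {n p q r ls ms} → GenPath S n p q ls → GenPath S n q r ms → GenPath S n p r (ls ++ ms)
  gnil _     ++ᵍ Q = Q
  gfwd e P   ++ᵍ Q = gfwd e (P ++ᵍ Q)
  gbwd e P   ++ᵍ Q = gbwd e (P ++ᵍ Q)

  end-vertex : ∀ {n p q ls} → GenPath S n p q ls → RauzyVertex S n q
  end-vertex (gnil v)   = v
  end-vertex (gfwd _ P) = end-vertex P
  end-vertex (gbwd _ P) = end-vertex P

  edge-source : ∀ {n p a q} → RauzyEdge S n p a q → RauzyVertex S n p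
  edge-source = proj₁

  edge-target : ∀ {n p a q} → RauzyEdge S n p a q → RauzyVertex S n q
  edge-target = proj₁ ∘ proj₂

  FibrePath : ℕ → Word k → Fin k → Fin k → Set
  FibrePath n w b b′ = Σ (List (Letter k)) λ ls → GenPath S (suc n) (b ∷ w) (b′ ∷ w) ls × ls ≈ []

  loops-at-empty : S [] → (∀ a → S (a ∷ [])) → ∀ g → GenPath S 0 [] [] g
  loops-at-empty s[] sa []           = gnil (s[] , refl)
  loops-at-empty s[] sa (inj₁ a ∷ g) = gfwd ((s[] , refl) , (s[] , refl) , sa a , a , refl) (loops-at-empty s[] sa g)
  loops-at-empty s[] sa (inj₂ a ∷ g) = gbwd ((s[] , refl) , (s[] , refl) , sa a , a , refl) (loops-at-empty s[] sa g)

  module _ (factorial : Factorial S) where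

    prefix-closed : ∀ w a → S (w ++ a ∷ []) → S w
    prefix-closed w a = factorial [] w (a ∷ [])

    suffix-closed : ∀ b w → S (b ∷ w) → S w
    suffix-closed b w s = factorial (b ∷ []) w [] (subst S (cong (b ∷_) (sym (++-identityʳ w))) s)

    snoc-edge : ∀ {n p} x a → length p ≡ n → S (x ∷ p ++ a ∷ []) →
                RauzyEdge S (suc n) (x ∷ p) a (p ++ a ∷ [])
    snoc-edge {p = p} x a lp s =
      (prefix-closed (x ∷ p) a s , cong suc lp) ,
      (suffix-closed x (p ++ a ∷ []) s , trans (length-++ p) (trans (+-comm (length p) 1) (cong suc lp))) ,
      s , x , refl

    extension-walk-path : ∀ {n w b b′} → length w ≡ n → S (b ∷ w) →
                          Star (ExtEdge S w) (inj₁ b) (inj₁ b′) → FibrePath n w b b′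
    extension-walk-path lw s ε = [] , gnil (s , cong suc lw) , ≈-refl
    extension-walk-path lw s (_◅_ {j = inj₁ _} () _)
    extension-walk-path lw s (_◅_ {j = inj₂ _} _ (_◅_ {j = inj₂ _} () _))
    extension-walk-path {w = w} {b} lw s (_◅_ {j = inj₂ a} s-baw (_◅_ {j = inj₁ c} s-caw walk)) =
      let (ls , P , P≈) = extension-walk-path lw (prefix-closed (c ∷ w) a s-caw) walk
      in inj₁ a ∷ inj₂ a ∷ ls ,
         gfwd (snoc-edge b a lw s-baw) (gbwd (snoc-edge c a lw s-caw) P) ,
         cancel-pair (inj₁ a) P≈

  module _ (connected : Connected S) where

    private
      factorial = proj₁ (proj₁ connected)
      biextendable = proj₂ (proj₁ connected)
      extension-graphs-connected = proj₂ connected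

    fibre-path : ∀ {n w b b′} → RauzyVertex S n w → S (b ∷ w) → S (b′ ∷ w) → FibrePath n w b b′
    fibre-path {w = w} {b} {b′} (sw , lw) s s′ =
      extension-walk-path factorial lw s (extension-graphs-connected w sw (inj₁ b) (inj₁ b′) s s′)

    lift-edge : ∀ {n p a q} → RauzyEdge S n p a q →
                Σ (Fin k) λ x → Σ (Fin k) λ c → RauzyEdge S (suc n) (x ∷ p) a (c ∷ q)
    lift-edge {p = p} {a} ((_ , lp) , _ , spa , c , pa≡cq) =
      let (x , y , s-xpay) = biextendable (p ++ a ∷ []) spa
          s-xpa = prefix-closed factorial (x ∷ p ++ a ∷ []) y s-xpay
      in x , c , subst (RauzyEdge S _ (x ∷ p) a) pa≡cq (snoc-edge factorial x a lp s-xpa)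

    lift-path : ∀ {n w w′ ls b} → GenPath S n w w′ ls → S (b ∷ w) →
                Σ (Fin k) λ b′ → Σ (List (Letter k)) λ ls′ →
                  GenPath S (suc n) (b ∷ w) (b′ ∷ w′) ls′ × ls′ ≈ ls
    lift-path (gnil (_ , lw)) s = _ , [] , gnil (s , cong suc lw) , ≈-refl
    lift-path (gfwd {a = a} e P) s =
      let (_ , _ , e′) = lift-edge e
          (lsF , F , F≈) = fibre-path (edge-source e) s (proj₁ (edge-source e′))
          (b′ , ls′ , P′ , P′≈) = lift-path P (proj₁ (edge-target e′))
      in b′ , lsF ++ inj₁ a ∷ ls′ , F ++ᵍ gfwd e′ P′ , ++-cong F≈ (∷-cong (inj₁ a) P′≈)
    lift-path (gbwd {a = a} e P) s =
      let (_ , _ , e′) = lift-edge e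
          (lsF , F , F≈) = fibre-path (edge-target e) s (proj₁ (edge-target e′))
          (b′ , ls′ , P′ , P′≈) = lift-path P (proj₁ (edge-source e′))
      in b′ , lsF ++ inj₂ a ∷ ls′ , F ++ᵍ gbwd e′ P′ , ++-cong F≈ (∷-cong (inj₂ a) P′≈)

    loop-with-value : (∀ a → S (a ∷ [])) → ∀ n {v} → RauzyVertex S n v → ∀ g →
                      Σ (List (Letter k)) λ ls → GenPath S n v v ls × ls ≈ g
    loop-with-value sa zero    {[]}    (s , _)  g = g , loops-at-empty s sa g , ≈-refl
    loop-with-value sa zero    {_ ∷ _} (_ , ())
    loop-with-value sa (suc n) {[]}    (_ , ())
    loop-with-value sa (suc n) {b ∷ w} (s , lv) g =
      let vw = suffix-closed factorial b w s , suc-injective lv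
          (ls , P , P≈) = loop-with-value sa n vw g
          (b′ , ls′ , Q , Q≈) = lift-path P s
          (lsF , F , F≈) = fibre-path vw (proj₁ (end-vertex Q)) s
      in ls′ ++ lsF , Q ++ᵍ F ,
         ≈-trans (++-cong Q≈ F≈) (≈-trans (≈-reflexive (++-identityʳ ls)) P≈)

theorem4p1 : (k : ℕ) (S : Lang (suc k)) → Recurrent S → Connected S
    → (∀ (a : Fin (suc k)) → S (a ∷ []))
    → (n : ℕ) (v : Word (suc k)) → S v → length v ≡ n
    → (g : List (Letter (suc k))) → InDescribedGroup S n v g ⇔ Reduced g
theorem4p1 k S _ connected sa n v sv lv g = mk⇔ value-reduced loop-for-reduced
  where
  open FreeGroup {suc k}
  open RauzyPaths S

  value-reduced : InDescribedGroup S n v g → Reduced g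
  value-reduced (ls , _ , refl) = reduce-Reduced ls

  loop-for-reduced : Reduced g → InDescribedGroup S n v g
  loop-for-reduced rg =
    let g′ = Reduced⇒Reduced′ g rg
        (ls , P , ls≈g) = loop-with-value connected sa n (sv , lv) g
    in ls , P , trans (reduce-cong ls≈g) (reduce-fixes-Reduced′ g g′)
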